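{- Let $M=\langle S,(\sim_i)_{i\in\mathcal{A}}\rangle$ be a Beth-Kripke model and let $\Theta$ be one of its Beth models ($\Theta=\Theta_s$ for some $s\in S$). Then for every node $\alpha\in\Theta$, every agent $i\in\mathcal{A}$, and every formula $\varphi\in L(\mathcal{A},\mathbf{AT})$: (a) $\alpha\Vdash_M\varphi$ iff there is a bar $B$ for $\alpha$ such that $\beta\Vdash_M\varphi$ for all $\beta\in B$; (b) $\alpha\not\Vdash_M\varphi$ iff there is a path $P$ through $\alpha$ such that $\beta\not\Vdash_M\varphi$ for every $\beta\in P$; (c) if $\alpha\leq\beta$ and $\alpha\Vdash_M\varphi$, then $\beta\Vdash_M\varphi$; (d) if $\alpha\Vdash_M K_i\varphi$, then $\beta\Vdash_M K_i\varphi$ for all $\beta\in\Theta$.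
   Context: $\mathbf{AT}$ is a nonempty set of propositional atoms and $\mathcal{A}$ a set of agents. A Beth model is a triple $\Theta=\langle Q,\leq,F\rangle$ where $(Q,\leq)$ is a partial order with a least element (the root) and $F:Q\to 2^{\mathbf{AT}}$ satisfies $F(\alpha)\subseteq F(\beta)$ whenever $\alpha\leq\beta$; we write $\alpha\in\Theta$ for $\alpha\in Q$. A path through $\alpha$ is a maximal linearly ordered subset of $Q$ containing $\alpha$; a bar for $\alpha$ is a subset of $Q$ meeting every path through $\alpha$. The language $L(\mathcal{A},\mathbf{AT})$ is the smallest set containing $\mathbf{AT}$ and closed under $\neg,\wedge,\vee,\rightarrow$ and $K_i$ ($i\in\mathcal{A}$). A Beth-Kripke model is $M=\langle S,(\sim_i)_{i\in\mathcal{A}}\rangle$ where $S$ is a nonempty set of Beth models over $\mathbf{AT}$ (each $s\in S$ is a Beth model $\Theta_s$ with root $\alpha_s$) and each $\sim_i$ is a binary relation on $S$. For $\Theta\in S$ and $\alpha\in\Theta$, satisfaction is defined inductively: $\alpha\Vdash_M p$ ($p\in\mathbf{AT}$) iff there is a bar $B$ for $\alpha$ with $p\in F(\beta)$ for all $\beta\in B$; $\alpha\Vdash_M\varphi\wedge\psi$ iff $\alpha\Vdash_M\varphi$ and $\alpha\Vdash_M\psi$; $\alpha\Vdash_M\varphi\vee\psi$ iff there is a bar $B\subseteq\Theta$ for $\alpha$ such that each $\beta\in B$ satisfies $\beta\Vdash_M\varphi$ or $\beta\Vdash_M\psi$; $\alpha\Vdash_M\varphi\rightarrow\psi$ iff for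 every $\beta\geq\alpha$ in $\Theta$, $\beta\Vdash_M\varphi$ implies $\beta\Vdash_M\psi$; $\alpha\Vdash_M\neg\varphi$ iff $\beta\not\Vdash_M\varphi$ for every $\beta\geq\alpha$ in $\Theta$; $\alpha\Vdash_M K_i\varphi$ iff for every $\Omega\in S$ with $\Theta\sim_i\Omega$ and every $\beta\in\Omega$, $\beta\Vdash_M\varphi$. -}

module Defs where

open import Level using (0ℓ) renaming (suc to lsuc)
open import Data.Product using (Σ; _×_; _,_)
open import Data.Sum using (_⊎_)
open import Relation.Nullary using (¬_)
open import Relation.Binary.PropositionalEquality using (_≡_)
open import Relation.Binary.Structures using (IsPartialOrder)

module _ {Q : Set} (_≤_ : Q → Q → Set) where

  IsChain : (Q → Set) → Set
  IsChain C = ∀ {x y} → C x → C y → (x ≤ y) ⊎ (y ≤ x)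

  IsMaximalChain : (Q → Set) → Set₁
  IsMaximalChain P =
    IsChain P × ((C : Q → Set) → IsChain C → (∀ x → P x → C x) → ∀ x → C x → P x)

  IsPath : Q → (Q → Set) → Set₁
  IsPath α P = P α × IsMaximalChain P

  IsBar : Q → (Q → Set) → Set₁
  IsBar α B = (P : Q → Set) → IsPath α P → Σ Q (λ β → P β × B β)

record BethModel (AT : Set) : Set₁ where
  field
    Q          : Set
    _≤_        : Q → Q → Set
    isPO       : IsPartialOrder _≡_ _≤_
    root       : Q
    root-least : ∀ x → root ≤ x
    F          : Q → AT → Set
    F-mono     : ∀ {α β} → α ≤ β → ∀ p → F α p → F β p

data Formula (A AT : Set) : Set where
  atom : AT → Formula A AT
  ¬'_  : Formula A AT → Formula A AT
  _∧'_ _∨'_ _⇒'_ : Formula A AT → Formula A AT → Formula A AT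
  K    : A → Formula A AT → Formula A AT

record BethKripke (A AT : Set) : Set₁ where
  field
    S     : Set
    s₀    : S
    Θ     : S → BethModel AT
    _∼⟨_⟩_ : S → A → S → Set

module Sat {A AT : Set} (M : BethKripke A AT) where
  open BethKripke M

  Node : S → Set
  Node s = BethModel.Q (Θ s)

  sat : (s : S) → Node s → Formula A AT → Set₁
  sat s α (atom p) = Σ (Node s → Set) λ B →
    IsBar (BethModel._≤_ (Θ s)) α B × (∀ β → B β → BethModel.F (Θ s) β p)
  sat s α (¬' φ) = ∀ β → BethModel._≤_ (Θ s) α β → ¬ sat s β φ
  sat s α (φ ∧' ψ) = sat s α φ × sat s α ψ
  sat s α (φ ∨' ψ) = Σ (Node s → Set) λ B →
    IsBar (BethModel._≤_ (Θ s)) α B × (∀ β → B β → sat s β φ ⊎ sat s β ψ)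
  sat s α (φ ⇒' ψ) = ∀ β → BethModel._≤_ (Θ s) α β → sat s β φ → sat s β ψ
  sat s α (K i φ) = ∀ t → s ∼⟨ i ⟩ t → ∀ (β : Node t) → sat t β φ

-- Classical principle used by the (classical) metatheory of the paper:
-- every chain in a partial order is contained in a maximal chain (Hausdorff).
MaximalChainPrinciple : Set₁
MaximalChainPrinciple =
  (Q : Set) (_≤_ : Q → Q → Set) → IsPartialOrder _≡_ _≤_ →
  (C : Q → Set) → IsChain _≤_ C →
  Σ (Q → Set) λ P → IsMaximalChain _≤_ P × (∀ x → C x → P x)

-- Persistence (c) is proved by induction on φ; the only non-trivial cases are
-- those whose semantics quantifies over a bar, where one needs that a bar for α
-- can be moved to any later node β.  Given a path P through β, the part of P
-- above β together with α extends to a path through α; the bar meets it in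
-- some γ comparable with β, and whichever of β, γ is larger lies in P above a
-- point of the bar.  Bar closure (a) is again an induction, using that bars of
-- bars are bars and that every bar is inhabited, since every node lies on a
-- path.  (b) follows from (a) classically: if no path through α avoids φ, then
-- the nodes forcing φ form a bar.  (d) holds because K i φ does not depend on
-- the node.
module Submission where

open import Defs
open import Level using (0ℓ; _⊔_) renaming (suc to lsuc)
open import Axiom.ExcludedMiddle using (ExcludedMiddle)
open import Data.Empty using (⊥-elim)
open import Data.Product using (Σ; _×_; _,_; proj₁; proj₂)
open import Data.Sum using (_⊎_; inj₁; inj₂; [_,_]′; swap)
open import Relation.Nullary using (¬_; yes; no)
open import Relation.Nullary.Decidable using (True; toWitness; fromWitness)
open import Relation.Binary.PropositionalEquality using (_≡_; refl)
open import Relation.Binary.Structures using (IsPartialOrder)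
open import Function.Bundles using (_⇔_; mk⇔)

module Bars {Q : Set} (_≤_ : Q → Q → Set) where

  Covered : ∀ {ℓ} → Q → (Q → Set ℓ) → Set (lsuc 0ℓ ⊔ ℓ)
  Covered α Φ = Σ (Q → Set) λ B → IsBar _≤_ α B × (∀ β → B β → Φ β)

  covered-refl : ∀ {ℓ} {Φ : Q → Set ℓ} {α} → Φ α → Covered α Φ
  covered-refl {α = α} Φα = (_≡ α) , (λ P path → α , proj₁ path , refl) , λ { _ refl → Φα }

  covered-map : ∀ {ℓ ℓ′} {Φ : Q → Set ℓ} {Ψ : Q → Set ℓ′} {α} →
                (∀ x → Φ x → Ψ x) → Covered α Φ → Covered α Ψ
  covered-map Φ⊆Ψ (B , bar , ΦB) = B , bar , λ x Bx → Φ⊆Ψ x (ΦB x Bx)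

  covered-join : ∀ {ℓ} {Φ : Q → Set ℓ} {α} → Covered α (λ β → Covered β Φ) → Covered α Φ
  covered-join (B , barB , coverAt) = B′ , barB′ , λ { x (β , Bβ , Cx) → proj₂ (proj₂ (coverAt β Bβ)) x Cx }
    where
      B′ : Q → Set
      B′ x = Σ Q λ β → Σ (B β) λ Bβ → proj₁ (coverAt β Bβ) x

      barB′ : IsBar _≤_ _ B′
      barB′ P (Pα , maxP) with barB P (Pα , maxP)
      ... | β , Pβ , Bβ with proj₁ (proj₂ (coverAt β Bβ)) P (Pβ , maxP)
      ... | γ , Pγ , Cγ = γ , Pγ , β , Bβ , Cγ

  covered-or-avoiding-path : ExcludedMiddle (lsuc 0ℓ) → (Φ : Q → Set₁) → ∀ α →
    Covered α Φ ⊎ Σ (Q → Set) (λ P → IsPath _≤_ α P × (∀ β → P β → ¬ Φ β))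
  covered-or-avoiding-path em Φ α with em {Σ (Q → Set) λ P → IsPath _≤_ α P × (∀ β → P β → ¬ Φ β)}
  ... | yes avoiding = inj₂ avoiding
  ... | no noAvoiding = inj₁ (Decided , bar , λ _ → toWitness)
    where
      -- Φ is Set₁-valued but bars are Set-valued; excluded middle resizes it.
      Decided : Q → Set
      Decided x = True (em {Φ x})

      bar : IsBar _≤_ α Decided
      bar P path with em {Σ Q λ β → P β × Φ β}
      ... | yes (β , Pβ , Φβ) = β , Pβ , fromWitness Φβ
      ... | no miss = ⊥-elim (noAvoiding (P , path , λ β Pβ Φβ → miss (β , Pβ , Φβ)))

module Paths (mcp : MaximalChainPrinciple) {Q : Set} {_≤_ : Q → Q → Set}
             (isPO : IsPartialOrder _≡_ _≤_) where
  open IsPartialOrder isPO using (trans) renaming (refl to ≤-refl)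
  open Bars _≤_

  Comparable : Q → Q → Set
  Comparable x y = x ≤ y ⊎ y ≤ x

  chain-∪-singleton : ∀ {P γ} → IsChain _≤_ P → (∀ {x} → P x → Comparable x γ) →
                      IsChain _≤_ (λ x → P x ⊎ x ≡ γ)
  chain-∪-singleton chainP cmp (inj₁ Px) (inj₁ Py) = chainP Px Py
  chain-∪-singleton chainP cmp (inj₁ Px) (inj₂ refl) = cmp Px
  chain-∪-singleton chainP cmp (inj₂ refl) (inj₁ Py) = swap (cmp Py)
  chain-∪-singleton chainP cmp (inj₂ refl) (inj₂ refl) = inj₁ ≤-refl

  maximal-chain-closed : ∀ {P γ} → IsMaximalChain _≤_ P → (∀ {x} → P x → Comparable x γ) → P γ
  maximal-chain-closed {γ = γ} (chainP , maxP) cmp =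
    maxP _ (chain-∪-singleton chainP cmp) (λ _ → inj₁) γ (inj₂ refl)

  path-through : ∀ β → Σ (Q → Set) (IsPath _≤_ β)
  path-through β with mcp Q _≤_ isPO (_≡ β) (λ { refl refl → inj₁ ≤-refl })
  ... | P , maxP , ⊇β = P , ⊇β β refl , maxP

  covered-inhabited : ∀ {ℓ} {Φ : Q → Set ℓ} {α} → Covered α Φ → Σ Q Φ
  covered-inhabited {α = α} (B , bar , ΦB) with path-through α
  ... | P , path with bar P path
  ... | β , _ , Bβ = β , ΦB β Bβ

  bar-restrict : ∀ {α β B} → α ≤ β → IsBar _≤_ α B →
                 IsBar _≤_ β (λ x → β ≤ x × Σ Q λ γ → B γ × γ ≤ x)
  bar-restrict {α} {β} α≤β bar P (Pβ , chainP , maxP)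
    with mcp Q _≤_ isPO _ (chain-∪-singleton {γ = α} (λ x y → chainP (proj₁ x) (proj₁ y))
                                                     (λ x → inj₂ (trans α≤β (proj₂ x))))
  ... | P′ , (chainP′ , maxP′) , ⊇P′ with bar P′ (⊇P′ α (inj₂ refl) , chainP′ , maxP′)
  ... | γ , P′γ , Bγ with chainP′ P′γ (⊇P′ β (inj₁ (Pβ , ≤-refl)))
  ... | inj₁ γ≤β = β , Pβ , ≤-refl , γ , Bγ , γ≤β
  ... | inj₂ β≤γ = γ , Pγ , β≤γ , γ , Bγ , ≤-refl
    where
      Pγ : P γ
      Pγ = maximal-chain-closed (chainP , maxP) λ {x} Px →
             [ (λ x≤β → inj₁ (trans x≤β β≤γ)) , (λ β≤x → chainP′ (⊇P′ x (inj₁ (Px , β≤x))) P′γ) ]′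
             (chainP Px Pβ)

  covered-restrict : ∀ {ℓ} {Φ : Q → Set ℓ} → (∀ {x y} → x ≤ y → Φ x → Φ y) →
                     ∀ {α β} → α ≤ β → Covered α Φ → Covered β (λ x → β ≤ x × Φ x)
  covered-restrict mono α≤β (B , bar , ΦB) =
    _ , bar-restrict α≤β bar , λ { x (β≤x , γ , Bγ , γ≤x) → β≤x , mono γ≤x (ΦB γ Bγ) }

module Forcing (mcp : MaximalChainPrinciple) {A AT : Set} (M : BethKripke A AT) (s : BethKripke.S M) where
  open BethKripke M using (Θ)
  open Sat M
  open BethModel (Θ s)
  open IsPartialOrder isPO using (trans) renaming (refl to ≤-refl)
  open Bars _≤_
  open Paths mcp isPO

  sat-mono : ∀ φ {α β} → α ≤ β → sat s α φ → sat s β φ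
  sat-mono (atom p) α≤β h = covered-map (λ _ → proj₂) (covered-restrict (λ x≤y → F-mono x≤y p) α≤β h)
  sat-mono (¬' φ) α≤β h γ β≤γ = h γ (trans α≤β β≤γ)
  sat-mono (φ ∧' ψ) α≤β (hφ , hψ) = sat-mono φ α≤β hφ , sat-mono ψ α≤β hψ
  sat-mono (φ ∨' ψ) α≤β h = covered-map (λ _ → proj₂) (covered-restrict mono-⊎ α≤β h)
    where
      mono-⊎ : ∀ {x y} → x ≤ y → sat s x φ ⊎ sat s x ψ → sat s y φ ⊎ sat s y ψ
      mono-⊎ x≤y = [ (λ hφ → inj₁ (sat-mono φ x≤y hφ)) , (λ hψ → inj₂ (sat-mono ψ x≤y hψ)) ]′
  sat-mono (φ ⇒' ψ) α≤β h γ β≤γ = h γ (trans α≤β β≤γ)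
  sat-mono (K i φ) α≤β h = h

  covered⇒sat : ∀ φ {α} → Covered α (λ β → sat s β φ) → sat s α φ
  covered⇒sat (atom p) h = covered-join h
  covered⇒sat (¬' φ) h β α≤β hφ with covered-inhabited (covered-restrict (sat-mono (¬' φ)) α≤β h)
  ... | x , β≤x , h¬φ = h¬φ x ≤-refl (sat-mono φ β≤x hφ)
  covered⇒sat (φ ∧' ψ) h = covered⇒sat φ (covered-map (λ _ → proj₁) h)
                          , covered⇒sat ψ (covered-map (λ _ → proj₂) h)
  covered⇒sat (φ ∨' ψ) h = covered-join h
  covered⇒sat (φ ⇒' ψ) h β α≤β hφ =
    covered⇒sat ψ (covered-map (λ { x (β≤x , h⇒) → h⇒ x ≤-refl (sat-mono φ β≤x hφ) })
                               (covered-restrict (sat-mono (φ ⇒' ψ)) α≤β h))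
  covered⇒sat (K i φ) h = proj₂ (covered-inhabited h)

theorem3 : ExcludedMiddle (lsuc 0ℓ) → MaximalChainPrinciple →
    {A AT : Set} → AT → (M : BethKripke A AT) →
    let open BethKripke M
        open Sat M
    in (s : S) (α : Node s) (i : A) (φ : Formula A AT) →
       let open BethModel (Θ s) using (_≤_)
       in (sat s α φ ⇔ Σ (Node s → Set) (λ B → IsBar _≤_ α B × (∀ β → B β → sat s β φ)))
        × ((¬ sat s α φ) ⇔ Σ (Node s → Set) (λ P → IsPath _≤_ α P × (∀ β → P β → ¬ sat s β φ)))
        × (∀ β → α ≤ β → sat s α φ → sat s β φ)
        × (sat s α (K i φ) → ∀ β → sat s β (K i φ))
theorem3 em mcp _ M s α i φ =
    mk⇔ covered-refl (covered⇒sat φ)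
  , mk⇔ avoiding-path (λ (P , path , ¬φ) → ¬φ α (proj₁ path))
  , (λ _ → sat-mono φ)
  , (λ h _ → h)
  where
    open Sat M
    open BethModel (BethKripke.Θ M s) using (_≤_)
    open Bars _≤_
    open Forcing mcp M s

    avoiding-path : ¬ sat s α φ → Σ (Node s → Set) (λ P → IsPath _≤_ α P × (∀ β → P β → ¬ sat s β φ))
    avoiding-path ¬φ with covered-or-avoiding-path em (λ β → sat s β φ) α
    ... | inj₁ covered = ⊥-elim (¬φ (covered⇒sat φ covered))
    ... | inj₂ path = path
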